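{- Let $r$ be a relation over a schema context on $U$, let $g$ be a reality and let $x,y\in L_U$. Then $L_r\models_g g(x)\to g(y)$ if and only if $L_r\models \pi_g(x)\to\pi_g(y)$.
   Context: A relation scheme is a finite set $U=\{A_1,\dots,A_n\}$ of attributes with domains $\mathrm{dom}(A)$. A schema context assigns to each $A$ a finite lattice $L_A$ (bottom $0_A$, top $1_A$) and a surjective comparability function $f_A:\mathrm{dom}(A)^2\to L_A$ with $f_A(u,u)=1_A$, $f_A(u,v)=f_A(v,u)$. $L_U=\prod_A L_A$ (componentwise order). A relation $r$ is a finite set of tuples; $f_U(t_1,t_2)=\langle f_{A_i}(t_1[A_i],t_2[A_i])\rangle_i$, $f_U(r)=\{f_U(t_1,t_2):t_1,t_2\in r\}$, $L_r=\{\bigwedge T: T\subseteq f_U(r)\}$ (empty meet = top). An attribute interpretation is an increasing $h_A:L_A\to\{0,1\}$ with $h_A(0_A)=0,h_A(1_A)=1$; a schema interpretation is $g(z)=\langle h_{A_1}(z[A_1]),\dots,h_{A_n}(z[A_n])\rangle$, identified with a subset of $U$. A reality is a schema interpretation that is a $\wedge$-homomorphism into $\{0,1\}^n$. $L_r\models_g g(x)\to g(y)$ means: for every $z\in L_r$, $g(x)\subseteq g(z)$ implies $g(y)\subseteq g(z)$. $L_r\models u\to v$ (for $u,v\in L_U$) means: for every $z\in L_r$, $u\le z$ implies $v\le z$. For a reality $g$, $x_g\in L_U$ has $x_g[A]=$ the least element of $\{x_A\in L_A: h_A(x_A)=1\}$, and $\pi_g(x)[A]=x_g[A]$ if $x[A]\ge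 x_g[A]$, $\pi_g(x)[A]=0_A$ otherwise. -}

module Defs where

open import Level using (0ℓ)
open import Data.Nat using (ℕ)
open import Data.Fin using (Fin)
open import Data.Bool using (Bool; true; false; _∧_) renaming (_≤_ to _≤ᵇ_)
open import Data.List using (List; foldr; map; filterᵇ)
open import Data.List.Relation.Unary.Any using (Any)
open import Data.List.Relation.Unary.All using (All)
open import Data.List.Membership.Propositional using (_∈_)
open import Data.Product using (_×_; _,_; ∃₂; proj₁; proj₂)
open import Relation.Nullary using (yes; no)
open import Relation.Binary using (Decidable)
open import Relation.Binary.PropositionalEquality using (_≡_)
open import Relation.Binary.Lattice.Bundles using (BoundedLattice)

record SchemaContext (n : ℕ) : Set₁ where
  field
    dom      : Fin n → Set
    L        : Fin n → BoundedLattice 0ℓ 0ℓ 0ℓ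
  module LA (A : Fin n) = BoundedLattice (L A)
  field
    -- finiteness of each L_A: an enumeration of all elements (up to ≈)
    elems    : (A : Fin n) → List (LA.Carrier A)
    elems-complete : (A : Fin n) (a : LA.Carrier A) → Any (λ b → LA._≈_ A a b) (elems A)
    -- the order of a finite lattice is decidable
    _≤?_     : (A : Fin n) → Decidable (LA._≤_ A)
    f        : (A : Fin n) → dom A → dom A → LA.Carrier A
    f-surj   : (A : Fin n) (l : LA.Carrier A) → ∃₂ λ u v → LA._≈_ A (f A u v) l
    f-refl   : (A : Fin n) (u : dom A) → LA._≈_ A (f A u u) (LA.⊤ A)
    f-sym    : (A : Fin n) (u v : dom A) → LA._≈_ A (f A u v) (f A v u)

module _ {n : ℕ} (S : SchemaContext n) where
  open SchemaContext S

  LU : Set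
  LU = (A : Fin n) → LA.Carrier A

  _≈U_ : LU → LU → Set
  x ≈U y = (A : Fin n) → LA._≈_ A (x A) (y A)

  _≤U_ : LU → LU → Set
  x ≤U y = (A : Fin n) → LA._≤_ A (x A) (y A)

  _∧U_ : LU → LU → LU
  (x ∧U y) A = LA._∧_ A (x A) (y A)

  ⊤U : LU
  ⊤U A = LA.⊤ A

  ⋀U : List LU → LU
  ⋀U = foldr _∧U_ ⊤U

  Tuple : Set
  Tuple = (A : Fin n) → dom A

  Relation : Set
  Relation = List Tuple

  fU : Tuple → Tuple → LU
  fU t₁ t₂ A = f A (t₁ A) (t₂ A)

  -- z ∈ L_r  iff  z = ⋀ T for some T ⊆ f_U(r)
  -- (T given as a list of pairs of tuples of r; empty meet = top)
  _∈L_ : LU → Relation → Set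
  z ∈L r = ∃₂ λ (T : List (Tuple × Tuple)) (_ : All (λ p → proj₁ p ∈ r × proj₂ p ∈ r) T) →
             z ≈U ⋀U (map (λ p → fU (proj₁ p) (proj₂ p)) T)

  record Interpretation : Set where
    field
      h      : (A : Fin n) → LA.Carrier A → Bool
      h-mono : (A : Fin n) {a b : LA.Carrier A} → LA._≤_ A a b → h A a ≤ᵇ h A b
      h-⊥    : (A : Fin n) → h A (LA.⊥ A) ≡ false
      h-⊤    : (A : Fin n) → h A (LA.⊤ A) ≡ true

  record Reality : Set where
    field
      interp : Interpretation
    open Interpretation interp public
    field
      h-∧ : (A : Fin n) (a b : LA.Carrier A) → h A (LA._∧_ A a b) ≡ (h A a ∧ h A b)

  -- g(x) ⊆ g(z), viewing g(x) as the subset {A | h_A(x[A]) = 1} of U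
  _⊆g[_]_ : LU → Interpretation → LU → Set
  x ⊆g[ g ] z = (A : Fin n) → Interpretation.h g A (x A) ≡ true → Interpretation.h g A (z A) ≡ true

  Models-g : Relation → Interpretation → LU → LU → Set
  Models-g r g x y = (z : LU) → z ∈L r → x ⊆g[ g ] z → y ⊆g[ g ] z

  Models : Relation → LU → LU → Set
  Models r u v = (z : LU) → z ∈L r → u ≤U z → v ≤U z

  -- x_g[A] = least element of {a ∈ L_A | h_A(a) = 1}, computed as the meet of
  -- that (finite) set
  xg : Reality → LU
  xg g A = foldr (LA._∧_ A) (LA.⊤ A) (filterᵇ (Reality.h g A) (elems A))

  π : Reality → LU → LU
  π g x A with (_≤?_ A) (xg g A) (x A)
  ... | yes _ = xg g A
  ... | no  _ = LA.⊥ A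

module Submission where

-- Both reduce to a single
-- pointwise fact, valid for every z ∈ L_U:
--
--     π_g(x) ≤ z   ⇔   g(x) ⊆ g(z).
--
-- Attribute-wise this holds because x_g[A] is the least element of L_A on
-- which h_A is true: if h_A(x[A]) = 1 then x_g[A] ≤ x[A], so π_g(x)[A] = x_g[A]
-- and x_g[A] ≤ z[A] iff h_A(z[A]) = 1 (monotonicity and leastness); if
-- h_A(x[A]) = 0 both sides hold trivially (π_g(x)[A] = 0_A).
-- That x_g[A] really is that least element needs the reality hypothesis:
-- h_A preserves ∧, so the meet of all h_A-true elements is itself h_A-true.

open import Defs
open import Level using (Level)
open import Data.Nat using (ℕ)
open import Data.Fin using (Fin)
open import Data.Bool using (Bool; true; false) renaming (_∧_ to _∧ᵇ_; _≤_ to _≤ᵇ_)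
open import Data.Bool.Base using (b≤b)
open import Data.List using (List; []; _∷_; foldr; filterᵇ)
open import Data.List.Relation.Unary.Any using (Any; here; there)
open import Function.Bundles using (_⇔_; mk⇔; module Equivalence)
open import Relation.Nullary using (yes; no)
open import Relation.Binary.PropositionalEquality using (_≡_; refl) renaming (trans to ≡-trans; sym to ≡-sym)
open import Relation.Binary.Lattice.Bundles using (BoundedLattice)

true≤⇒true : ∀ {b} → true ≤ᵇ b → b ≡ true
true≤⇒true b≤b = refl

∧ᵇ-true : ∀ {a b} → a ≡ true → b ≡ true → (a ∧ᵇ b) ≡ true
∧ᵇ-true refl refl = refl

module FilteredMeet {c ℓ₁ ℓ₂ : Level} (L : BoundedLattice c ℓ₁ ℓ₂)
                    (p : BoundedLattice.Carrier L → Bool) where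
  open BoundedLattice L

  ⋀-satisfying : List Carrier → Carrier
  ⋀-satisfying l = foldr _∧_ ⊤ (filterᵇ p l)

  ⋀-satisfying-satisfies : p ⊤ ≡ true → (∀ a b → p (a ∧ b) ≡ (p a ∧ᵇ p b)) →
                           (l : List Carrier) → p (⋀-satisfying l) ≡ true
  ⋀-satisfying-satisfies p-⊤ p-∧ [] = p-⊤
  ⋀-satisfying-satisfies p-⊤ p-∧ (b ∷ l) with p b in pb
  ... | true  = ≡-trans (p-∧ b _) (∧ᵇ-true pb (⋀-satisfying-satisfies p-⊤ p-∧ l))
  ... | false = ⋀-satisfying-satisfies p-⊤ p-∧ l

  ⋀-satisfying-lower : (∀ {a b} → a ≤ b → p a ≡ true → p b ≡ true) →
                       ∀ {a} → p a ≡ true → (l : List Carrier) → Any (a ≈_) l →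
                       ⋀-satisfying l ≤ a
  ⋀-satisfying-lower p-up pa (b ∷ l) (here a≈b) with p b in pb
  ... | true  = trans (x∧y≤x _ _) (reflexive (Eq.sym a≈b))
  ... | false with () ← ≡-trans (≡-sym (p-up (reflexive a≈b) pa)) pb
  ⋀-satisfying-lower p-up pa (b ∷ l) (there a∈l) with p b
  ... | true  = trans (x∧y≤y _ _) (⋀-satisfying-lower p-up pa l a∈l)
  ... | false = ⋀-satisfying-lower p-up pa l a∈l

module RealityFacts {n : ℕ} (S : SchemaContext n) (g : Reality S) where
  open SchemaContext S
  open Reality g

  module _ (A : Fin n) where
    open LA A
    open FilteredMeet (L A) (h A)

    h-upward : ∀ {a b} → a ≤ b → h A a ≡ true → h A b ≡ true
    h-upward {a} {b} a≤b ha with h A a | h-mono A a≤b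
    h-upward {a} {b} a≤b refl | true | true≤hb = true≤⇒true true≤hb

    xg-true : h A (xg S g A) ≡ true
    xg-true = ⋀-satisfying-satisfies (h-⊤ A) (h-∧ A) (elems A)

    xg-least : ∀ {a} → h A a ≡ true → xg S g A ≤ a
    xg-least {a} ha = ⋀-satisfying-lower h-upward ha (elems A) (elems-complete A a)

    π-below⇔ : (x z : LU S) →
               (π S g x A ≤ z A) ⇔ (h A (x A) ≡ true → h A (z A) ≡ true)
    π-below⇔ x z with (_≤?_ A) (xg S g A) (x A)
    ... | yes xg≤x = mk⇔ (λ xg≤z _ → h-upward xg≤z xg-true)
                         (λ hx⇒hz → xg-least (hx⇒hz (h-upward xg≤x xg-true)))
    ... | no  xg≰x = mk⇔ (λ _ hx → contradiction (xg-least hx))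
                         (λ _ → minimum (z A))
      where contradiction : xg S g A ≤ x A → h A (z A) ≡ true
            contradiction xg≤x with () ← xg≰x xg≤x

  π-below⇔⊆ : (x z : LU S) → _≤U_ S (π S g x) z ⇔ _⊆g[_]_ S x interp z
  π-below⇔⊆ x z = mk⇔ (λ πx≤z A → Equivalence.to (π-below⇔ A x z) (πx≤z A))
                      (λ x⊆z A → Equivalence.from (π-below⇔ A x z) (x⊆z A))

theorem2 : {n : ℕ} (S : SchemaContext n) (r : Relation S) (g : Reality S) (x y : LU S) →
    Models-g S r (Reality.interp g) x y ⇔ Models S r (π S g x) (π S g y)
theorem2 S r g x y = mk⇔
  (λ g-implication z z∈r πx≤z →
     from (π-below⇔⊆ y z) (g-implication z z∈r (to (π-below⇔⊆ x z) πx≤z)))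
  (λ π-implication z z∈r x⊆z →
     to (π-below⇔⊆ y z) (π-implication z z∈r (from (π-below⇔⊆ x z) x⊆z)))
  where
    open RealityFacts S g
    open Equivalence
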